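{- Suppose $(\mathsf P,\mathsf{Opens})$ is a semitopology and $p\in\mathsf P$. Then: \begin{enumerate} \item $\overline{\{p\}}\subseteq p_{\between}$. \item The subset inclusion may be strict; that is, $\overline{\{p\}}\subsetneq p_{\between}$ is possible --- even if $p$ is regular. \item If $\mathrm{interior}(\overline{\{p\}})\neq\varnothing$ (so $\overline{\{p\}}$ has a nonempty interior) then $\overline{\{p\}}=p_{\between}$. \end{enumerate}
   Context: A semitopology is a pair $(\mathsf P,\mathsf{Opens})$ with $\mathsf{Opens}\subseteq\mathcal P(\mathsf P)$ containing $\varnothing$ and $\mathsf P$ and closed under arbitrary unions. Points $p,p'$ are intertwined when every open neighbourhood of $p$ intersects every open neighbourhood of $p'$; $p_{\between}$ denotes the set of points intertwined with $p$. $\overline X$ is the closure of $X$ (points every open neighbourhood of which intersects $X$), and $\mathrm{interior}(X)$ is the union of open sets contained in $X$. The community of $p$ is $K(p)=\mathrm{interior}(p_{\between})$; $p$ is regular when $p\in K(p)$ and $K(p)$ is nonempty, open and transitive (for all open $O,O'$, if $O\cap K(p)\neq\varnothing$ and $K(p)\cap O'\neq\varnothing$ then $O\cap O'\neq\varnothing$). -}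

module Defs where

open import Level using (Level; _⊔_; 0ℓ) renaming (suc to lsuc)
open import Data.Product using (Σ; ∃; _×_; _,_)
open import Data.Empty using (⊥)
open import Data.Unit using (⊤)
open import Relation.Binary.PropositionalEquality using (_≡_)

Subset : ∀ {ℓ} (A : Set) → Set (lsuc ℓ)
Subset {ℓ} A = A → Set ℓ

_⊆_ : ∀ {A : Set} {ℓ₁ ℓ₂} → Subset {ℓ₁} A → Subset {ℓ₂} A → Set (ℓ₁ ⊔ ℓ₂)
X ⊆ Y = ∀ x → X x → Y x

Nonempty : ∀ {A : Set} {ℓ} → Subset {ℓ} A → Set ℓ
Nonempty {A} X = Σ A X

Meets : ∀ {A : Set} {ℓ₁ ℓ₂} → Subset {ℓ₁} A → Subset {ℓ₂} A → Set (ℓ₁ ⊔ ℓ₂)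
Meets {A} X Y = Σ A (λ x → X x × Y x)

｛_｝ : ∀ {A : Set} → A → Subset {0ℓ} A
｛ p ｝ = λ x → x ≡ p

-- Since subsets are
-- predicates, we also require Opens to be closed under extensional equality
-- of subsets (automatic when subsets are sets).
record Semitopology : Set₁ where
  field
    Pt     : Set
    Open   : Subset {0ℓ} Pt → Set
    open-∅ : Open (λ _ → ⊥)
    open-P : Open (λ _ → ⊤)
    open-⋃ : (I : Set) (U : I → Subset {0ℓ} Pt) →
             (∀ i → Open (U i)) → Open (λ x → Σ I (λ i → U i x))
    open-ext : (O O′ : Subset {0ℓ} Pt) → O ⊆ O′ → O′ ⊆ O → Open O → Open O′

module _ (S : Semitopology) where
  open Semitopology S

  IsOpen : ∀ {ℓ} → Subset {ℓ} Pt → Set (lsuc 0ℓ ⊔ ℓ)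
  IsOpen X = Σ (Subset {0ℓ} Pt) (λ O → Open O × O ⊆ X × X ⊆ O)

  Intertwined : Pt → Pt → Set₁
  Intertwined p p′ = (O O′ : Subset {0ℓ} Pt) → Open O → Open O′ → O p → O′ p′ → Meets O O′

  intertwinedWith : Pt → Subset {lsuc 0ℓ} Pt
  intertwinedWith p = λ p′ → Intertwined p p′

  closure : ∀ {ℓ} → Subset {ℓ} Pt → Subset {lsuc 0ℓ ⊔ ℓ} Pt
  closure X = λ x → (O : Subset {0ℓ} Pt) → Open O → O x → Meets O X

  interior : ∀ {ℓ} → Subset {ℓ} Pt → Subset {lsuc 0ℓ ⊔ ℓ} Pt
  interior X = λ x → Σ (Subset {0ℓ} Pt) (λ O → Open O × O ⊆ X × O x)

  K : Pt → Subset {lsuc 0ℓ} Pt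
  K p = interior (intertwinedWith p)

  Transitive : ∀ {ℓ} → Subset {ℓ} Pt → Set (lsuc 0ℓ ⊔ ℓ)
  Transitive T = (O O′ : Subset {0ℓ} Pt) → Open O → Open O′ →
                 Meets O T → Meets T O′ → Meets O O′

  Regular : Pt → Set₁
  Regular p = K p p × Nonempty (K p) × IsOpen (K p) × Transitive (K p)

-- A point lies in the closure of {p} exactly when every open neighbourhood of it contains p,
-- so such a point is intertwined with p.  Conversely, a nonempty open O ⊆ cl{p} contains p;
-- if q is intertwined with p, every open neighbourhood of q meets O in a point of cl{p}, hence
-- contains p.  In the Sierpiński space every two points are intertwined, which makes every
-- point regular, yet the open point does not lie in the closure of the closed point.
module Submission where

open import Defs
open import Data.Bool using (Bool; true; false)
open import Data.Product using (Σ; _×_; _,_)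
open import Data.Unit using (⊤; tt)
open import Relation.Binary.PropositionalEquality using (_≡_; refl)
open import Relation.Nullary using (¬_)

module _ (S : Semitopology) where
  open Semitopology S

  closure-singleton⇒open-nbhd-∋ : ∀ {p q} → closure S ｛ p ｝ q →
                                  ∀ O → Open O → O q → O p
  closure-singleton⇒open-nbhd-∋ cl O oO Oq with cl O oO Oq
  ... | _ , Op , refl = Op

  closure-singleton⊆intertwined : ∀ p → closure S ｛ p ｝ ⊆ intertwinedWith S p
  closure-singleton⊆intertwined p q cl O O′ oO oO′ Op O′q =
    p , Op , closure-singleton⇒open-nbhd-∋ cl O′ oO′ O′q

  intertwined⊆closure-singleton : ∀ p → Nonempty (interior S (closure S ｛ p ｝)) →
                                  intertwinedWith S p ⊆ closure S ｛ p ｝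
  intertwined⊆closure-singleton p (x , O , oO , O⊆cl , Ox) q p≬q O′ oO′ O′q
    with p≬q O O′ oO oO′ (closure-singleton⇒open-nbhd-∋ (O⊆cl x Ox) O oO Ox) O′q
  ... | z , Oz , O′z = p , closure-singleton⇒open-nbhd-∋ (O⊆cl z Oz) O′ oO′ O′z , refl

  all-intertwined⇒regular : (∀ p q → Intertwined S p q) → ∀ p → Regular S p
  all-intertwined⇒regular p≬q p =
    everything⊆K p , (p , everything⊆K p) ,
    ((λ _ → ⊤) , open-P , (λ x _ → everything⊆K x) , (λ _ _ → tt)) ,
    λ { O O′ oO oO′ (x , Ox , _) (y , _ , O′y) → p≬q x y O O′ oO oO′ Ox O′y }
    where
    everything⊆K : ∀ x → K S p x
    everything⊆K x = (λ _ → ⊤) , open-P , (λ y _ → p≬q p y) , tt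

-- The opens are ∅, {false} and Bool: false is the open point, true the closed one.
Sierpiński : Semitopology
Sierpiński = record
  { Pt       = Bool
  ; Open     = λ O → O true → O false
  ; open-∅   = λ ()
  ; open-P   = λ _ → tt
  ; open-⋃   = λ { I U oU (i , Ui) → i , oU i Ui }
  ; open-ext = λ O O′ O⊆O′ O′⊆O oO O′t → O⊆O′ false (oO (O′⊆O true O′t))
  }

module _ where
  open Semitopology Sierpiński

  open-nbhd-∋false : ∀ O → Open O → ∀ x → O x → O false
  open-nbhd-∋false O oO true  Ot = oO Ot
  open-nbhd-∋false O oO false Of = Of

  sierpiński-intertwined : ∀ p q → Intertwined Sierpiński p q
  sierpiński-intertwined p q O O′ oO oO′ Op O′q =
    false , open-nbhd-∋false O oO p Op , open-nbhd-∋false O′ oO′ q O′q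

  false∉closure-true : ¬ closure Sierpiński ｛ true ｝ false
  false∉closure-true cl with cl ｛ false ｝ (λ ()) refl
  ... | _ , refl , ()

proposition5p63 :
    ((S : Semitopology) (p : Semitopology.Pt S) →
        closure S ｛ p ｝ ⊆ intertwinedWith S p)
    ×
    Σ Semitopology (λ S → Σ (Semitopology.Pt S) (λ p →
        Regular S p
        × closure S ｛ p ｝ ⊆ intertwinedWith S p
        × Σ (Semitopology.Pt S) (λ q → intertwinedWith S p q × ¬ closure S ｛ p ｝ q)))
    ×
    ((S : Semitopology) (p : Semitopology.Pt S) →
        Nonempty (interior S (closure S ｛ p ｝)) →
        (closure S ｛ p ｝ ⊆ intertwinedWith S p) × (intertwinedWith S p ⊆ closure S ｛ p ｝))
proposition5p63 =
  closure-singleton⊆intertwined ,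
  ( Sierpiński , true
  , all-intertwined⇒regular Sierpiński sierpiński-intertwined true
  , closure-singleton⊆intertwined Sierpiński true
  , false , sierpiński-intertwined true false , false∉closure-true) ,
  λ S p int≠∅ → closure-singleton⊆intertwined S p , intertwined⊆closure-singleton S p int≠∅
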